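{- For every $\varepsilon>0$ there is a graph $G$ such that $$\frac{\operatorname{cdim}(G)}{\operatorname{mdim}(G)}\leq \varepsilon.$$
   Context: All graphs are nonempty, finite, simple and undirected. For distinct vertices $v,w$ of a graph $G$, $\kappa(v,w)$ denotes the maximum number of internally vertex-disjoint $v$–$w$ paths in $G$; by convention $\kappa(v,v)=\infty$. For an ordered vertex set $W=\{w_1,\ldots,w_k\}\subseteq V(G)$, the connectivity representation of $v$ is $r(v,W)=[\kappa(v,w_1),\ldots,\kappa(v,w_k)]$. $W$ is resolving for $G$ if $r(v_1,W)=r(v_2,W)$ implies $v_1=v_2$ for all $v_1,v_2\in V(G)$. The connectivity dimension $\operatorname{cdim}(G)$ is the minimum cardinality of a resolving set of $G$. The metric dimension $\operatorname{mdim}(G)$ is defined analogously with the distance $d(v,w)$ in place of $\kappa(v,w)$: it is the minimum cardinality of a set $W=\{w_1,\ldots,w_k\}$ such that the vectors $[d(v,w_1),\ldots,d(v,w_k)]$, $v\in V(G)$, are pairwise distinct. -}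

module Defs where

open import Data.Nat using (ℕ; zero; suc; _≤_)
open import Data.Bool using (Bool; true; false)
open import Data.Fin using (Fin)
open import Data.Fin.Subset using (Subset; _∈_; ∣_∣)
open import Data.List using (List; []; _∷_; _∷ʳ_)
open import Data.List.Relation.Unary.Linked using (Linked)
open import Data.List.Relation.Unary.Unique.Propositional using (Unique)
open import Data.List.Relation.Unary.All using (All)
import Data.List.Membership.Propositional as LM
open import Data.Vec using (Vec; lookup)
open import Data.Product using (Σ; ∃; _×_; _,_)
open import Relation.Binary.PropositionalEquality using (_≡_; _≢_)
open import Relation.Nullary using (¬_)

record Graph (n : ℕ) : Set where
  field
    adj   : Fin n → Fin n → Bool
    sym   : ∀ u v → adj u v ≡ adj v u
    irrefl : ∀ v → adj v v ≡ false

module _ {n : ℕ} (G : Graph n) where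
  open Graph G

  Adj : Fin n → Fin n → Set
  Adj u v = adj u v ≡ true

  -- A v–w path (v ≢ w) given by its list of internal vertices mid:
  -- the vertex sequence v ∷ mid ++ [w] has pairwise distinct entries
  -- and consecutive entries are adjacent.
  IsPath : Fin n → Fin n → List (Fin n) → Set
  IsPath v w mid = Linked Adj ((v ∷ mid) ∷ʳ w) × Unique ((v ∷ mid) ∷ʳ w)

  Disjoint : List (Fin n) → List (Fin n) → Set
  Disjoint xs ys = All (λ x → ¬ (x LM.∈ ys)) xs

  HasDisjointPaths : Fin n → Fin n → ℕ → Set
  HasDisjointPaths v w k =
    Σ (Vec (List (Fin n)) k) λ ps →
      (∀ i → IsPath v w (lookup ps i)) ×
      (∀ i j → i ≢ j → (lookup ps i ≢ lookup ps j) × Disjoint (lookup ps i) (lookup ps j))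

data ℕ∞ : Set where
  fin : ℕ → ℕ∞
  ∞   : ℕ∞

module _ {n : ℕ} (G : Graph n) where
  open Graph G

  Kappa : Fin n → Fin n → ℕ∞ → Set
  Kappa v w ∞       = v ≡ w
  Kappa v w (fin k) = v ≢ w × HasDisjointPaths G v w k
                      × (∀ k' → HasDisjointPaths G v w k' → k' ≤ k)

  data Walk : Fin n → Fin n → ℕ → Set where
    here : ∀ {v} → Walk v v 0
    step : ∀ {u v w d} → Adj G u v → Walk v w d → Walk u w (suc d)

  Dist : Fin n → Fin n → ℕ∞ → Set
  Dist v w ∞       = ∀ d → ¬ Walk v w d
  Dist v w (fin d) = Walk v w d × (∀ d' → Walk v w d' → d ≤ d')

Resolving : {n : ℕ} → (Fin n → Fin n → ℕ∞ → Set) → Subset n → Set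
Resolving {n} R W = ∀ (v₁ v₂ : Fin n) →
  (∀ w → w ∈ W → ∃ λ x → R v₁ w x × R v₂ w x) → v₁ ≡ v₂

IsDim : {n : ℕ} → (Fin n → Fin n → ℕ∞ → Set) → ℕ → Set
IsDim {n} R d = (∃ λ W → Resolving R W × ∣ W ∣ ≡ d)
              × (∀ W → Resolving R W → d ≤ ∣ W ∣)

IsCdim : {n : ℕ} → Graph n → ℕ → Set
IsCdim G = IsDim (Kappa G)

IsMdim : {n : ℕ} → Graph n → ℕ → Set
IsMdim G = IsDim (Dist G)

-- If u is a universal vertex then all distances are at most 2, and κ(v,u) = κ(u,v) = deg v:
-- the edge uv and the paths v–z–u through the other neighbours z of v are internally disjoint,
-- and every v–u path other than the edge has an interior vertex among these z.
--
-- Take the threshold graph on 0, …, r+1 with r = 2s, where a ~ b iff a ≠ b and r ≤ a + b. The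
-- vertices r and r+1 are universal, and s−1 and s have the same neighbours. A κ-resolving set W
-- must contain a universal vertex u (otherwise r and r+1 both have κ = deg w to every w ∈ W), and
-- another vertex (otherwise κ(s−1,u) = deg(s−1) = deg s = κ(s,u)). Conversely {r+1, s} resolves,
-- since deg a = a+2 for a < s and deg a = a+1 for s ≤ a ≤ r. Hence cdim = 2.
-- As distances are 0, 1 or 2, the vertices 2j and 2j+1 are separated only by 2j, 2j+1 and
-- r−1−2j. For 2K ≤ s these K triples are disjoint, so mdim ≥ K; for ε = p/q take K = 2q.

module Submission where

open import Defs
open import Level using (0ℓ)
open import Data.Nat
  using (ℕ; zero; suc; _+_; _∸_; _*_; _≤_; _<_; z≤n; s≤s; s≤s⁻¹; z<s; _≤?_; _<?_; _≟_; ⌊_/2⌋; _⊓_; >-nonZero)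
open import Data.Nat.Properties
open import Data.Nat.Induction using (<-rec)
open import Data.Bool using (true; if_then_else_)
import Data.Bool as Bool
open import Data.Fin using (Fin; zero; suc; toℕ; fromℕ<) renaming (_≟_ to _≟ᶠ_)
open import Data.Fin.Properties using (toℕ-injective; toℕ<n; toℕ-fromℕ<; injective⇒≤; any?; all?)
import Data.Fin.Properties as Fin
open import Data.Fin.Subset using (Subset; _∈_; _∉_; ∣_∣; ⁅_⁆; _∪_; inside; outside)
import Data.Fin.Subset as Subset
open import Data.Fin.Subset.Properties using (_∈?_; ∈⊤; x∈⁅x⁆; x∈p∪q⁺; ∣⁅x⁆∣≡1; anySubset?)
open import Data.List using (List; []; _∷_; _++_; length; filter; tabulate; allFin; lookup)
open import Data.List.Properties using (∷-injectiveˡ)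
open import Data.List.Relation.Unary.Linked using (Linked; [-]; _∷_)
open import Data.List.Relation.Unary.AllPairs using ([]; _∷_)
open import Data.List.Relation.Unary.All as All using ([]; _∷_)
open import Data.List.Relation.Unary.Any as Any using (here; there)
open import Data.List.Relation.Unary.Any.Properties using (lookup-index)
open import Data.List.Relation.Unary.Unique.Propositional using (Unique)
import Data.List.Relation.Unary.Unique.Propositional.Properties as Unique
open import Data.List.Membership.Propositional using () renaming (_∈_ to _∈ˡ_)
open import Data.List.Membership.Propositional.Properties
  using (∈-filter⁺; ∈-filter⁻; ∈-allFin; ∈-++⁺ˡ; ∈-++⁺ʳ; ∈-lookup)
open import Data.Vec using ([]; _∷_; here; there)
import Data.Vec as Vec
open import Data.Vec.Properties using (lookup∘tabulate)
open import Data.Product using (Σ; ∃; _×_; _,_; proj₁; proj₂)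
open import Data.Sum using (_⊎_; inj₁; inj₂)
open import Function using (_∘_; _⇔_; mk⇔; Equivalence; Injective)
open import Relation.Nullary using (Dec; yes; no; does; contradiction; ¬?)
open import Relation.Nullary.Decidable using (_×-dec_; _→-dec_; does-⇔; dec-false; decidable-stable; map′)
open import Relation.Unary using (Pred; Decidable)
open import Relation.Binary.PropositionalEquality
  using (_≡_; _≢_; refl; sym; trans; cong; cong₂; subst; subst₂; module ≡-Reasoning)

open Equivalence using (to; from)

-- Counting

does≡true⇔ : ∀ {A : Set} (a? : Dec A) → does a? ≡ true ⇔ A
does≡true⇔ (yes a) = mk⇔ (λ _ → a) (λ _ → refl)
does≡true⇔ (no ¬a) = mk⇔ (λ ()) (λ a → contradiction a ¬a)

countBelow : {P : Pred ℕ 0ℓ} → Decidable P → ℕ → ℕ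
countBelow P? zero    = 0
countBelow P? (suc n) =
  if does (P? 0) then suc (countBelow (λ i → P? (suc i)) n) else countBelow (λ i → P? (suc i)) n

countBelow-cong : {P Q : Pred ℕ 0ℓ} (P? : Decidable P) (Q? : Decidable Q) →
                  (∀ i → P i ⇔ Q i) → ∀ n → countBelow P? n ≡ countBelow Q? n
countBelow-cong P? Q? P⇔Q zero = refl
countBelow-cong P? Q? P⇔Q (suc n) with P? 0 | Q? 0
... | yes _ | yes _ = cong suc (countBelow-cong _ _ (λ i → P⇔Q (suc i)) n)
... | no  _ | no  _ = countBelow-cong _ _ (λ i → P⇔Q (suc i)) n
... | yes p | no ¬q = contradiction (to (P⇔Q 0) p) ¬q
... | no ¬p | yes q = contradiction (from (P⇔Q 0) q) ¬p

length-filter-tabulate : {A : Set} {Q : Pred A 0ℓ} (Q? : Decidable Q) {P : Pred ℕ 0ℓ} (P? : Decidable P) →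
                         ∀ {n} (h : Fin n → A) → (∀ i → Q (h i) ⇔ P (toℕ i)) →
                         length (filter Q? (tabulate h)) ≡ countBelow P? n
length-filter-tabulate Q? P? {zero}  h Q⇔P = refl
length-filter-tabulate Q? P? {suc n} h Q⇔P with Q? (h zero) | P? 0
... | yes _ | yes _ = cong suc (length-filter-tabulate Q? _ (λ i → h (suc i)) (λ i → Q⇔P (suc i)))
... | no  _ | no  _ = length-filter-tabulate Q? _ (λ i → h (suc i)) (λ i → Q⇔P (suc i))
... | yes q | no ¬p = contradiction (to (Q⇔P zero) q) ¬p
... | no ¬q | yes p = contradiction (from (Q⇔P zero) p) ¬q

countBelow-threshold : ∀ c k → countBelow (c ≤?_) (c + k) ≡ k
countBelow-threshold zero    zero    = refl
countBelow-threshold zero    (suc k) =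
  cong suc (trans (countBelow-cong _ _ (λ _ → mk⇔ (λ _ → z≤n) (λ _ → z≤n)) k) (countBelow-threshold zero k))
countBelow-threshold (suc c) k       =
  trans (countBelow-cong _ _ (λ _ → mk⇔ s≤s⁻¹ s≤s) (c + k)) (countBelow-threshold c k)

≢-suc⇔ : {P : Pred ℕ 0ℓ} {a : ℕ} → ∀ i → (P i × i ≢ a) ⇔ (P i × suc i ≢ suc a)
≢-suc⇔ i = mk⇔ (λ (p , i≢a) → p , λ { refl → i≢a refl }) (λ (p , 1+i≢1+a) → p , λ { refl → 1+i≢1+a refl })

countBelow-remove : {P : Pred ℕ 0ℓ} (P? : Decidable P) → ∀ {a n} → a < n → P a →
                    countBelow P? n ≡ suc (countBelow (λ i → P? i ×-dec ¬? (i ≟ a)) n)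
countBelow-remove P? {zero} {suc n} _ Pa with P? 0
... | yes _ = cong suc (countBelow-cong _ _ (λ _ → mk⇔ (λ p → p , λ ()) proj₁) n)
... | no ¬p = contradiction Pa ¬p
countBelow-remove P? {suc a} {suc n} a<n Pa with P? 0
... | yes _ = cong suc (trans (countBelow-remove _ (s≤s⁻¹ a<n) Pa) (cong suc (countBelow-cong _ _ ≢-suc⇔ n)))
... | no  _ = trans (countBelow-remove _ (s≤s⁻¹ a<n) Pa) (cong suc (countBelow-cong _ _ ≢-suc⇔ n))

-- Resolving sets and dimensions

rank : ∀ {n} (W : Subset n) {x} → x ∈ W → Fin ∣ W ∣
rank (inside  ∷ W) here      = zero
rank (inside  ∷ W) (there p) = suc (rank W p)
rank (outside ∷ W) (there p) = rank W p

rank-injective : ∀ {n} (W : Subset n) {x y} (p : x ∈ W) (q : y ∈ W) → rank W p ≡ rank W q → x ≡ y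
rank-injective (inside  ∷ W) here      here      _ = refl
rank-injective (inside  ∷ W) (there p) (there q) e = cong suc (rank-injective W p q (Fin.suc-injective e))
rank-injective (outside ∷ W) (there p) (there q) e = cong suc (rank-injective W p q e)

injection⇒≤∣W∣ : ∀ {k n} (W : Subset n) (f : Fin k → Fin n) → Injective _≡_ _≡_ f → (∀ i → f i ∈ W) →
                 k ≤ ∣ W ∣
injection⇒≤∣W∣ W f f-injective f∈W = injective⇒≤ (f-injective ∘ rank-injective W (f∈W _) (f∈W _))

two-elements⇒2≤∣W∣ : ∀ {n} (W : Subset n) {x y} → x ∈ W → y ∈ W → x ≢ y → 2 ≤ ∣ W ∣
two-elements⇒2≤∣W∣ W {x} {y} x∈W y∈W x≢y = injection⇒≤∣W∣ W f f-injective f∈W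
  where
  f : Fin 2 → _
  f zero       = x
  f (suc zero) = y
  f-injective : Injective _≡_ _≡_ f
  f-injective {zero}     {zero}     _ = refl
  f-injective {zero}     {suc zero} e = contradiction e x≢y
  f-injective {suc zero} {zero}     e = contradiction (sym e) x≢y
  f-injective {suc zero} {suc zero} _ = refl
  f∈W : ∀ i → f i ∈ W
  f∈W zero       = x∈W
  f∈W (suc zero) = y∈W

∣p∪q∣≤∣p∣+∣q∣ : ∀ {n} (p q : Subset n) → ∣ p ∪ q ∣ ≤ ∣ p ∣ + ∣ q ∣
∣p∪q∣≤∣p∣+∣q∣ []            []            = z≤n
∣p∪q∣≤∣p∣+∣q∣ (inside  ∷ p) (inside  ∷ q) =
  s≤s (≤-trans (∣p∪q∣≤∣p∣+∣q∣ p q) (+-monoʳ-≤ ∣ p ∣ (n≤1+n ∣ q ∣)))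
∣p∪q∣≤∣p∣+∣q∣ (inside  ∷ p) (outside ∷ q) = s≤s (∣p∪q∣≤∣p∣+∣q∣ p q)
∣p∪q∣≤∣p∣+∣q∣ (outside ∷ p) (inside  ∷ q) =
  subst (suc ∣ p ∪ q ∣ ≤_) (sym (+-suc ∣ p ∣ ∣ q ∣)) (s≤s (∣p∪q∣≤∣p∣+∣q∣ p q))
∣p∪q∣≤∣p∣+∣q∣ (outside ∷ p) (outside ∷ q) = ∣p∪q∣≤∣p∣+∣q∣ p q

least-satisfying : {Q : Pred ℕ 0ℓ} → Decidable Q → ∀ {n} → Q n → ∃ λ d → Q d × (∀ {d′} → Q d′ → d ≤ d′)
least-satisfying {Q} Q? {n} = <-rec (λ m → Q m → ∃ Least) search n
  where
  Least : ℕ → Set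
  Least d = Q d × (∀ {d′} → Q d′ → d ≤ d′)
  search : ∀ m → (∀ {k} → k < m → Q k → ∃ Least) → Q m → ∃ Least
  search m below Qm with anyUpTo? Q? m
  ... | yes (k , k<m , Qk) = below k<m Qk
  ... | no  none           = m , Qm , λ Qd′ → ≮⇒≥ (λ d′<m → none (_ , d′<m , Qd′))

IsDim-exists : ∀ {n} {R : Fin n → Fin n → ℕ∞ → Set} → Decidable (Resolving R) →
               ∀ {W₀} → Resolving R W₀ → ∃ (IsDim R)
IsDim-exists {R = R} resolving? {W₀} W₀-resolves =
  let d , (W , W-resolves , ∣W∣≡d) , minimal = least-satisfying resolvingOfSize? (W₀ , W₀-resolves , refl)
  in d , (W , W-resolves , ∣W∣≡d) , λ W′ W′-resolves → minimal (W′ , W′-resolves , refl)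
  where
  resolvingOfSize? : Decidable (λ d → ∃ λ W → Resolving R W × ∣ W ∣ ≡ d)
  resolvingOfSize? d = anySubset? (λ W → resolving? W ×-dec (∣ W ∣ ≟ d))

IsDim-lower : ∀ {n} {R : Fin n → Fin n → ℕ∞ → Set} {d k} → IsDim R d →
              (∀ W → Resolving R W → k ≤ ∣ W ∣) → k ≤ d
IsDim-lower ((W , W-resolves , ∣W∣≡d) , _) bound = subst (_ ≤_) ∣W∣≡d (bound W W-resolves)

Functional : ∀ {n} → (Fin n → Fin n → ℕ∞ → Set) → Set
Functional R = ∀ {v w x y} → R v w x → R v w y → x ≡ y

fin-injective : ∀ {a b} → fin a ≡ fin b → a ≡ b
fin-injective refl = refl

shared-value : ∀ {n} {R : Fin n → Fin n → ℕ∞ → Set} → Functional R → ∀ {v₁ v₂ w a b} →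
               R v₁ w a → R v₂ w b → (∃ λ x → R v₁ w x × R v₂ w x) → a ≡ b
shared-value R-functional r₁ r₂ (x , r₁′ , r₂′) = trans (R-functional r₁ r₁′) (R-functional r₂′ r₂)

module _ {n} {R : Fin n → Fin n → ℕ∞ → Set} (R-functional : Functional R)
         (ρ : Fin n → Fin n → ℕ) (R-ρ : ∀ v w → R v w (fin (ρ v w))) where

  private
    agree⇔ρ≡ : ∀ {v₁ v₂ w} → (∃ λ x → R v₁ w x × R v₂ w x) ⇔ (ρ v₁ w ≡ ρ v₂ w)
    agree⇔ρ≡ {v₁} {v₂} {w} = mk⇔
      (fin-injective ∘ shared-value {R = R} R-functional (R-ρ v₁ w) (R-ρ v₂ w))
      (λ ρ≡ → fin (ρ v₁ w) , R-ρ v₁ w , subst (R v₂ w ∘ fin) (sym ρ≡) (R-ρ v₂ w))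

  Resolving⇔ : ∀ W → Resolving R W ⇔ (∀ v₁ v₂ → (∀ w → w ∈ W → ρ v₁ w ≡ ρ v₂ w) → v₁ ≡ v₂)
  Resolving⇔ W = mk⇔
    (λ resolves v₁ v₂ same → resolves v₁ v₂ λ w w∈W → from agree⇔ρ≡ (same w w∈W))
    (λ resolves v₁ v₂ agree → resolves v₁ v₂ λ w w∈W → to agree⇔ρ≡ (agree w w∈W))

  resolving? : Decidable (Resolving R)
  resolving? W = map′ (from (Resolving⇔ W)) (to (Resolving⇔ W))
    (all? λ v₁ → all? λ v₂ → all? (λ w → w ∈? W →-dec ρ v₁ w ≟ ρ v₂ w) →-dec v₁ ≟ᶠ v₂)

  resolving-separates : ∀ {W} → Resolving R W → ∀ {v₁ v₂} → v₁ ≢ v₂ → ∃ λ w → w ∈ W × ρ v₁ w ≢ ρ v₂ w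
  resolving-separates {W} resolves {v₁} {v₂} v₁≢v₂ with any? (λ w → w ∈? W ×-dec ¬? (ρ v₁ w ≟ ρ v₂ w))
  ... | yes separator = separator
  ... | no  none      = contradiction (to (Resolving⇔ W) resolves v₁ v₂ agree) v₁≢v₂
    where
    agree : ∀ w → w ∈ W → ρ v₁ w ≡ ρ v₂ w
    agree w w∈W = decidable-stable (ρ v₁ w ≟ ρ v₂ w) λ ρ≢ → none (w , w∈W , ρ≢)

-- Paths, connectivity and distance

lookup-injective : ∀ {A : Set} {xs : List A} → Unique xs → ∀ {i j} → lookup xs i ≡ lookup xs j → i ≡ j
lookup-injective (_ ∷ _)         {zero}  {zero}  _ = refl
lookup-injective (x∉xs ∷ _)      {zero}  {suc j} e = contradiction e (All.lookup x∉xs (∈-lookup j))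
lookup-injective (x∉xs ∷ _)      {suc i} {zero}  e = contradiction (sym e) (All.lookup x∉xs (∈-lookup i))
lookup-injective (_ ∷ xs-unique) {suc i} {suc j} e = cong suc (lookup-injective xs-unique e)

Linked-last : ∀ {A : Set} {R : A → A → Set} {w} z zs → Linked R (z ∷ zs ++ w ∷ []) →
              ∃ λ y → y ∈ˡ z ∷ zs × R y w
Linked-last z []        (Rzw ∷ [-]) = z , here refl , Rzw
Linked-last z (z′ ∷ zs) (_ ∷ rest)  = let y , y∈ , Ryw = Linked-last z′ zs rest in y , there y∈ , Ryw

module _ {n : ℕ} (G : Graph n) where
  open Graph G using (adj)

  Adj? : ∀ v w → Dec (Adj G v w)
  Adj? v w = adj v w Bool.≟ true

  Adj-sym : ∀ {v w} → Adj G v w → Adj G w v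
  Adj-sym {v} {w} = trans (Graph.sym G w v)

  Adj⇒≢ : ∀ {v w} → Adj G v w → v ≢ w
  Adj⇒≢ {v} vv refl with trans (sym vv) (Graph.irrefl G v)
  ... | ()

  Universal : Fin n → Set
  Universal u = ∀ z → z ≢ u → Adj G u z

  neighboursExcept : Fin n → Fin n → List (Fin n)
  neighboursExcept v u = filter (λ z → Adj? v z ×-dec ¬? (z ≟ᶠ u)) (allFin n)

  Kappa-functional : Functional (Kappa G)
  Kappa-functional {x = ∞}     {∞}     _ _                 = refl
  Kappa-functional {x = ∞}     {fin _} v≡w (v≢w , _)       = contradiction v≡w v≢w
  Kappa-functional {x = fin _} {∞}     (v≢w , _) v≡w       = contradiction v≡w v≢w
  Kappa-functional {x = fin a} {fin b} (_ , a-paths , a-max) (_ , b-paths , b-max) =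
    cong fin (≤-antisym (b-max a a-paths) (a-max b b-paths))

  Kappa-landmark : ∀ {v v′ w} → (∃ λ x → Kappa G v w x × Kappa G v′ w x) → v ≡ w → v′ ≡ w
  Kappa-landmark (∞     , _         , v′≡w) _   = v′≡w
  Kappa-landmark (fin _ , (v≢w , _) , _)    v≡w = contradiction v≡w v≢w

  Kappa-resolving : ∀ W → (∀ v₁ v₂ → v₁ ∉ W → v₂ ∉ W →
                             (∀ w → w ∈ W → ∃ λ x → Kappa G v₁ w x × Kappa G v₂ w x) → v₁ ≡ v₂) →
                    Resolving (Kappa G) W
  Kappa-resolving W resolves-outside v₁ v₂ agree with v₁ ∈? W | v₂ ∈? W
  ... | yes v₁∈W | _        = sym (Kappa-landmark (agree v₁ v₁∈W) refl)
  ... | no _     | yes v₂∈W = let x , κ₁ , κ₂ = agree v₂ v₂∈W in Kappa-landmark (x , κ₂ , κ₁) refl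
  ... | no v₁∉W  | no v₂∉W  = resolves-outside v₁ v₂ v₁∉W v₂∉W agree

  edge-path : ∀ {v w} → Adj G v w → IsPath G v w []
  edge-path vw = vw ∷ [-] , (Adj⇒≢ vw ∷ []) ∷ [] ∷ []

  two-edge-path : ∀ {v z w} → Adj G v z → Adj G z w → v ≢ w → IsPath G v w (z ∷ [])
  two-edge-path vz zw v≢w = vz ∷ zw ∷ [-] , (Adj⇒≢ vz ∷ v≢w ∷ []) ∷ (Adj⇒≢ zw ∷ []) ∷ [] ∷ []

  first-interior : ∀ {v w z zs} → IsPath G v w (z ∷ zs) → Adj G v z × z ≢ w
  first-interior {zs = zs} (vz ∷ _ , _ ∷ z∉ ∷ _) = vz , All.lookup z∉ (∈-++⁺ʳ zs (here refl))

  last-interior : ∀ {v w z zs} → IsPath G v w (z ∷ zs) → ∃ λ y → y ∈ˡ z ∷ zs × Adj G y w × v ≢ y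
  last-interior {z = z} {zs} (_ ∷ linked , v∉ ∷ _) =
    let y , y∈ , yw = Linked-last z zs linked in y , y∈ , yw , All.lookup v∉ (∈-++⁺ˡ y∈)

  family⇒HasDisjointPaths : ∀ {v w k} (P : Fin k → List (Fin n)) → (∀ i → IsPath G v w (P i)) →
                            (∀ i j → i ≢ j → P i ≢ P j × Disjoint G (P i) (P j)) →
                            HasDisjointPaths G v w k
  family⇒HasDisjointPaths {v} {w} P paths apart =
    Vec.tabulate P ,
    (λ i → subst (IsPath G v w) (sym (lookup∘tabulate P i)) (paths i)) ,
    (λ i j i≢j → subst₂ (λ X Y → X ≢ Y × Disjoint G X Y)
                        (sym (lookup∘tabulate P i)) (sym (lookup∘tabulate P j)) (apart i j i≢j))

  module _ {v w} (L : List (Fin n))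
           (meets : ∀ {z zs} → IsPath G v w (z ∷ zs) → ∃ λ y → y ∈ˡ z ∷ zs × y ∈ˡ L) where

    private
      label : ∀ mid → IsPath G v w mid → Fin (suc (length L))
      label []      _ = zero
      label (_ ∷ _) p = suc (Any.index (proj₂ (proj₂ (meets p))))

      label-collision : ∀ mid p mid′ p′ → label mid p ≡ label mid′ p′ →
                        mid ≡ mid′ ⊎ ∃ λ y → y ∈ˡ mid × y ∈ˡ mid′
      label-collision []      _ []      _  _ = inj₁ refl
      label-collision (_ ∷ _) p (_ ∷ _) p′ e
        with y , y∈mid , y∈L ← meets p | y′ , y′∈mid′ , y′∈L ← meets p′ =
        inj₂ (y , y∈mid , subst (_∈ˡ _) (sym y≡y′) y′∈mid′)
        where
        y≡y′ : y ≡ y′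
        y≡y′ = trans (lookup-index y∈L) (trans (cong (lookup L) (Fin.suc-injective e)) (sym (lookup-index y′∈L)))

    disjointPaths≤1+separator : ∀ {k} → HasDisjointPaths G v w k → k ≤ suc (length L)
    disjointPaths≤1+separator (ps , paths , apart) = injective⇒≤ labels-injective
      where
      labels-injective : Injective _≡_ _≡_ (λ i → label (Vec.lookup ps i) (paths i))
      labels-injective {i} {j} e with i ≟ᶠ j
      ... | yes i≡j = i≡j
      ... | no  i≢j with label-collision _ (paths i) _ (paths j) e
      ...   | inj₁ same            = contradiction same (proj₁ (apart i j i≢j))
      ...   | inj₂ (y , y∈i , y∈j) = contradiction y∈j (All.lookup (proj₂ (apart i j i≢j)) y∈i)

  module _ {u v} (u-universal : Universal u) (v≢u : v ≢ u) where

    private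
      N : List (Fin n)
      N = neighboursExcept v u

      N-sound : ∀ {z} → z ∈ˡ N → Adj G v z × z ≢ u
      N-sound z∈N = proj₂ (∈-filter⁻ (λ z → Adj? v z ×-dec ¬? (z ≟ᶠ u)) {xs = allFin n} z∈N)

      N-complete : ∀ {z} → Adj G v z → z ≢ u → z ∈ˡ N
      N-complete vz z≢u = ∈-filter⁺ (λ z → Adj? v z ×-dec ¬? (z ≟ᶠ u)) (∈-allFin _) (vz , z≢u)

      detour : Fin (suc (length N)) → List (Fin n)
      detour zero    = []
      detour (suc j) = lookup N j ∷ []

      detours-apart : ∀ i j → i ≢ j → detour i ≢ detour j × Disjoint G (detour i) (detour j)
      detours-apart zero    zero    i≢j = contradiction refl i≢j
      detours-apart zero    (suc j) _   = (λ ()) , []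
      detours-apart (suc i) zero    _   = (λ ()) , (λ ()) ∷ []
      detours-apart (suc i) (suc j) i≢j = (λ e → zᵢ≢zⱼ (∷-injectiveˡ e)) , (λ { (here e) → zᵢ≢zⱼ e }) ∷ []
        where
        zᵢ≢zⱼ : lookup N i ≢ lookup N j
        zᵢ≢zⱼ e = i≢j (cong suc (lookup-injective (Unique.filter⁺ _ (Unique.allFin⁺ n)) e))

      detour-to-u : ∀ i → IsPath G v u (detour i)
      detour-to-u zero    = edge-path (Adj-sym (u-universal v v≢u))
      detour-to-u (suc j) =
        let vz , z≢u = N-sound (∈-lookup j) in two-edge-path vz (Adj-sym (u-universal _ z≢u)) v≢u

      detour-from-u : ∀ i → IsPath G u v (detour i)
      detour-from-u zero    = edge-path (u-universal v v≢u)
      detour-from-u (suc j) =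
        let vz , z≢u = N-sound (∈-lookup j) in two-edge-path (u-universal _ z≢u) (Adj-sym vz) (v≢u ∘ sym)

    Kappa-to-universal : Kappa G v u (fin (suc (length (neighboursExcept v u))))
    Kappa-to-universal =
      v≢u , family⇒HasDisjointPaths detour detour-to-u detours-apart ,
      λ k paths → disjointPaths≤1+separator N meets paths
      where
      meets : ∀ {z zs} → IsPath G v u (z ∷ zs) → ∃ λ y → y ∈ˡ z ∷ zs × y ∈ˡ N
      meets {z} p = let vz , z≢u = first-interior p in z , here refl , N-complete vz z≢u

    Kappa-from-universal : Kappa G u v (fin (suc (length (neighboursExcept v u))))
    Kappa-from-universal =
      v≢u ∘ sym , family⇒HasDisjointPaths detour detour-from-u detours-apart ,
      λ k paths → disjointPaths≤1+separator N meets paths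
      where
      meets : ∀ {z zs} → IsPath G u v (z ∷ zs) → ∃ λ y → y ∈ˡ z ∷ zs × y ∈ˡ N
      meets p = let y , y∈ , yv , u≢y = last-interior p in y , y∈ , N-complete (Adj-sym yv) (u≢y ∘ sym)

  dist : Fin n → Fin n → ℕ
  dist v w = if does (v ≟ᶠ w) then 0 else if does (Adj? v w) then 1 else 2

  walk₀⇒≡ : ∀ {v w} → Walk G v w 0 → v ≡ w
  walk₀⇒≡ here = refl

  walk₁⇒Adj : ∀ {v w} → Walk G v w 1 → Adj G v w
  walk₁⇒Adj (step vw here) = vw

  Dist-dist : ∀ {u} → Universal u → ∀ v w → Dist G v w (fin (dist v w))
  Dist-dist {u} u-universal v w with v ≟ᶠ w | Adj? v w
  ... | yes refl | _      = here , λ _ _ → z≤n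
  ... | no v≢w   | yes vw = step vw here , shortest
    where
    shortest : ∀ d → Walk G v w d → 1 ≤ d
    shortest zero    walk = contradiction (walk₀⇒≡ walk) v≢w
    shortest (suc _) _    = s≤s z≤n
  ... | no v≢w   | no ¬vw = step (Adj-sym (u-universal v v≢u)) (step (u-universal w w≢u) here) , shortest
    where
    v≢u : v ≢ u
    v≢u refl = ¬vw (u-universal w (v≢w ∘ sym))
    w≢u : w ≢ u
    w≢u refl = ¬vw (Adj-sym (u-universal v v≢w))
    shortest : ∀ d → Walk G v w d → 2 ≤ d
    shortest zero          walk = contradiction (walk₀⇒≡ walk) v≢w
    shortest (suc zero)    walk = contradiction (walk₁⇒Adj walk) ¬vw
    shortest (suc (suc _)) _    = s≤s (s≤s z≤n)

  dist-cong : ∀ {x y w} → x ≢ w → y ≢ w → (Adj G x w ⇔ Adj G y w) → dist x w ≡ dist y w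
  dist-cong {x} {y} {w} x≢w y≢w x~w⇔y~w with x ≟ᶠ w | y ≟ᶠ w
  ... | yes x≡w | _       = contradiction x≡w x≢w
  ... | no _    | yes y≡w = contradiction y≡w y≢w
  ... | no _    | no _    = cong (if_then 1 else 2) (does-⇔ x~w⇔y~w (Adj? x w) (Adj? y w))

  Dist-functional : Functional (Dist G)
  Dist-functional {x = ∞}     {∞}     _ _                 = refl
  Dist-functional {x = ∞}     {fin _} none (walk , _)     = contradiction walk (none _)
  Dist-functional {x = fin _} {∞}     (walk , _) none     = contradiction walk (none _)
  Dist-functional {x = fin a} {fin b} (walk-a , a-min) (walk-b , b-min) =
    cong fin (≤-antisym (a-min b walk-b) (b-min a walk-a))

  Dist-⊤-resolving : Resolving (Dist G) Subset.⊤
  Dist-⊤-resolving v₁ v₂ agree =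
    let x , d₁ , d₂ = agree v₁ ∈⊤
        x≡0 = Dist-functional d₁ (here , λ _ _ → z≤n)
    in sym (walk₀⇒≡ (proj₁ (subst (Dist G v₂ v₁) x≡0 d₂)))

mdim-exists : ∀ {n} (G : Graph n) {u} → Universal G u → ∃ (IsMdim G)
mdim-exists G u-universal =
  IsDim-exists (resolving? (Dist-functional G) (dist G) (Dist-dist G u-universal)) (Dist-⊤-resolving G)

-- A threshold graph

module ThresholdGraph (t : ℕ) where

  s r M : ℕ
  s = suc t
  r = s + s
  M = suc (suc r)

  Adjacent : ℕ → ℕ → Set
  Adjacent a b = a ≢ b × r ≤ a + b

  adjacent? : ∀ a b → Dec (Adjacent a b)
  adjacent? a b = ¬? (a ≟ b) ×-dec (r ≤? a + b)

  threshold : Graph M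
  threshold = record
    { adj    = λ i j → does (adjacent? (toℕ i) (toℕ j))
    ; sym    = λ i j → does-⇔ (mk⇔ swap swap) (adjacent? (toℕ i) (toℕ j)) (adjacent? (toℕ j) (toℕ i))
    ; irrefl = λ i → dec-false (adjacent? (toℕ i) (toℕ i)) λ (i≢i , _) → i≢i refl
    }
    where
    swap : ∀ {a b} → Adjacent a b → Adjacent b a
    swap {a} {b} (a≢b , r≤a+b) = a≢b ∘ sym , subst (r ≤_) (+-comm a b) r≤a+b

  Adj⇔Adjacent : ∀ {i j} → Adj threshold i j ⇔ Adjacent (toℕ i) (toℕ j)
  Adj⇔Adjacent {i} {j} = does≡true⇔ (adjacent? (toℕ i) (toℕ j))

  universal : ∀ {u} → r ≤ toℕ u → Universal threshold u
  universal {u} r≤u z z≢u = from Adj⇔Adjacent (z≢u ∘ sym ∘ toℕ-injective , m≤n⇒m≤n+o (toℕ z) r≤u)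

  degree : ℕ → ℕ
  degree a = countBelow (adjacent? a) M

  1+neighboursExcept≡degree : ∀ {u v} → r ≤ toℕ u → v ≢ u →
                              suc (length (neighboursExcept threshold v u)) ≡ degree (toℕ v)
  1+neighboursExcept≡degree {u} {v} r≤u v≢u = sym (begin
    degree (toℕ v)                                ≡⟨ countBelow-remove (adjacent? (toℕ v)) (toℕ<n u) v~u ⟩
    suc (countBelow neighbour? M)                 ≡⟨ cong suc (length-filter-tabulate Adj∖u? neighbour? (λ z → z) as-ℕ) ⟨
    suc (length (neighboursExcept threshold v u)) ∎)
    where
    open ≡-Reasoning
    Adj∖u? : ∀ z → Dec (Adj threshold v z × z ≢ u)
    Adj∖u? z = Adj? threshold v z ×-dec ¬? (z ≟ᶠ u)
    neighbour? : ∀ z → Dec (Adjacent (toℕ v) z × z ≢ toℕ u)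
    neighbour? z = adjacent? (toℕ v) z ×-dec ¬? (z ≟ toℕ u)
    v~u : Adjacent (toℕ v) (toℕ u)
    v~u = to Adj⇔Adjacent (Adj-sym threshold {u} {v} (universal r≤u v v≢u))
    as-ℕ : ∀ z → (Adj threshold v z × z ≢ u) ⇔ (Adjacent (toℕ v) (toℕ z) × toℕ z ≢ toℕ u)
    as-ℕ z = mk⇔ (λ (vz , z≢u) → to Adj⇔Adjacent vz , z≢u ∘ toℕ-injective)
                 (λ (v~z , z≢u) → from Adj⇔Adjacent v~z , z≢u ∘ cong toℕ)

  Kappa-to-universal-degree : ∀ {u v} → r ≤ toℕ u → v ≢ u → Kappa threshold v u (fin (degree (toℕ v)))
  Kappa-to-universal-degree r≤u v≢u =
    subst (Kappa threshold _ _ ∘ fin) (1+neighboursExcept≡degree r≤u v≢u) (Kappa-to-universal threshold (universal r≤u) v≢u)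

  Kappa-from-universal-degree : ∀ {u v} → r ≤ toℕ u → v ≢ u → Kappa threshold u v (fin (degree (toℕ v)))
  Kappa-from-universal-degree r≤u v≢u =
    subst (Kappa threshold _ _ ∘ fin) (1+neighboursExcept≡degree r≤u v≢u) (Kappa-from-universal threshold (universal r≤u) v≢u)

  private
    r≤a+z⇔r∸a≤z : ∀ a z → r ≤ a + z ⇔ r ∸ a ≤ z
    r≤a+z⇔r∸a≤z a z = mk⇔ (m≤n+o⇒m∸n≤o r a) (λ r∸a≤z → ≤-trans (m≤n+m∸n r a) (+-monoʳ-≤ a r∸a≤z))

    count-upper≡2+a : ∀ {a} → a ≤ r → countBelow (r ∸ a ≤?_) M ≡ suc (suc a)
    count-upper≡2+a {a} a≤r = subst (λ m → countBelow (r ∸ a ≤?_) m ≡ suc (suc a)) M≡r∸a+[2+a]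
                                    (countBelow-threshold (r ∸ a) (suc (suc a)))
      where
      M≡r∸a+[2+a] : (r ∸ a) + suc (suc a) ≡ M
      M≡r∸a+[2+a] = trans (+-suc (r ∸ a) (suc a)) (cong suc (trans (+-suc (r ∸ a) a) (cong suc (m∸n+n≡m a≤r))))

  degree-below-half : ∀ {a} → a < s → degree a ≡ suc (suc a)
  degree-below-half {a} a<s = trans (countBelow-cong (adjacent? a) (r ∸ a ≤?_) upper M) (count-upper≡2+a a≤r)
    where
    a≤r : a ≤ r
    a≤r = m≤n⇒m≤n+o s (<⇒≤ a<s)
    a<r∸a : a < r ∸ a
    a<r∸a = m+n≤o⇒m≤o∸n (suc a) (+-mono-< a<s a<s)
    upper : ∀ z → Adjacent a z ⇔ r ∸ a ≤ z
    upper z = mk⇔ (to (r≤a+z⇔r∸a≤z a z) ∘ proj₂)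
                  (λ r∸a≤z → (λ { refl → <⇒≱ a<r∸a r∸a≤z }) , from (r≤a+z⇔r∸a≤z a z) r∸a≤z)

  degree-above-half : ∀ {a} → s ≤ a → a ≤ r → degree a ≡ suc a
  degree-above-half {a} s≤a a≤r = suc-injective (begin
    suc (degree a)              ≡⟨ cong suc (countBelow-cong (adjacent? a) upper∖a? upper M) ⟩
    suc (countBelow upper∖a? M) ≡⟨ countBelow-remove (r ∸ a ≤?_) (s≤s (m≤n⇒m≤1+n a≤r)) r∸a≤a ⟨
    countBelow (r ∸ a ≤?_) M    ≡⟨ count-upper≡2+a a≤r ⟩
    suc (suc a)                 ∎)
    where
    open ≡-Reasoning
    upper∖a? : ∀ z → Dec (r ∸ a ≤ z × z ≢ a)
    upper∖a? z = (r ∸ a ≤? z) ×-dec ¬? (z ≟ a)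
    r∸a≤a : r ∸ a ≤ a
    r∸a≤a = m≤n+o⇒m∸n≤o r a (+-mono-≤ s≤a s≤a)
    upper : ∀ z → Adjacent a z ⇔ (r ∸ a ≤ z × z ≢ a)
    upper z = mk⇔ (λ (a≢z , r≤a+z) → to (r≤a+z⇔r∸a≤z a z) r≤a+z , a≢z ∘ sym)
                  (λ (r∸a≤z , z≢a) → z≢a ∘ sym , from (r≤a+z⇔r∸a≤z a z) r∸a≤z)

  degree-below≢above : ∀ {a b} → a < s → s ≤ b → b ≤ r → b ≢ s → degree a ≢ degree b
  degree-below≢above {a} {b} a<s s≤b b≤r b≢s deg≡ = b≢s (≤-antisym (subst (_≤ s) 1+a≡b a<s) s≤b)
    where
    1+a≡b : suc a ≡ b
    1+a≡b = suc-injective (trans (sym (degree-below-half a<s)) (trans deg≡ (degree-above-half s≤b b≤r)))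

  degree-injective : ∀ {a b} → a ≤ r → b ≤ r → a ≢ s → b ≢ s → degree a ≡ degree b → a ≡ b
  degree-injective {a} {b} a≤r b≤r a≢s b≢s deg≡ with a <? s | b <? s
  ... | yes a<s | yes b<s =
    suc-injective (suc-injective (trans (sym (degree-below-half a<s)) (trans deg≡ (degree-below-half b<s))))
  ... | no  a≮s | no  b≮s =
    suc-injective (trans (sym (degree-above-half (≮⇒≥ a≮s) a≤r)) (trans deg≡ (degree-above-half (≮⇒≥ b≮s) b≤r)))
  ... | yes a<s | no  b≮s = contradiction deg≡ (degree-below≢above a<s (≮⇒≥ b≮s) b≤r b≢s)
  ... | no  a≮s | yes b<s = contradiction (sym deg≡) (degree-below≢above b<s (≮⇒≥ a≮s) a≤r a≢s)

  s≤r : s ≤ r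
  s≤r = m≤m+n s s

  r<M : r < M
  r<M = m<n⇒m<1+n (n<1+n r)

  s<M : s < M
  s<M = ≤-<-trans s≤r r<M

  u₁ u₂ twin₁ twin₂ : Fin M
  u₁    = fromℕ< r<M
  u₂    = fromℕ< (n<1+n (suc r))
  twin₁ = fromℕ< (<-trans (n<1+n t) s<M)
  twin₂ = fromℕ< s<M

  toℕ-u₁ : toℕ u₁ ≡ r
  toℕ-u₁ = toℕ-fromℕ< r<M

  toℕ-u₂ : toℕ u₂ ≡ suc r
  toℕ-u₂ = toℕ-fromℕ< (n<1+n (suc r))

  toℕ-twin₁ : toℕ twin₁ ≡ t
  toℕ-twin₁ = toℕ-fromℕ< (<-trans (n<1+n t) s<M)

  toℕ-twin₂ : toℕ twin₂ ≡ s
  toℕ-twin₂ = toℕ-fromℕ< s<M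

  r≤u₁ : r ≤ toℕ u₁
  r≤u₁ = ≤-reflexive (sym toℕ-u₁)

  r≤u₂ : r ≤ toℕ u₂
  r≤u₂ = ≤-trans (n≤1+n r) (≤-reflexive (sym toℕ-u₂))

  u₁≢u₂ : u₁ ≢ u₂
  u₁≢u₂ u₁≡u₂ = <⇒≢ (n<1+n r) (trans (sym toℕ-u₁) (trans (cong toℕ u₁≡u₂) toℕ-u₂))

  twin₁≢twin₂ : twin₁ ≢ twin₂
  twin₁≢twin₂ e = <⇒≢ (n<1+n t) (trans (sym toℕ-twin₁) (trans (cong toℕ e) toℕ-twin₂))

  twins-agree-at-universal : ∀ {u} → r ≤ toℕ u → ∃ λ x → Kappa threshold twin₁ u x × Kappa threshold twin₂ u x
  twins-agree-at-universal {u} r≤u =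
    fin (suc s) ,
    subst (Kappa threshold twin₁ u ∘ fin) degree-twin₁ (Kappa-to-universal-degree r≤u (below-universal t<r)) ,
    subst (Kappa threshold twin₂ u ∘ fin) degree-twin₂ (Kappa-to-universal-degree r≤u (below-universal s<r))
    where
    t<r : toℕ twin₁ < r
    t<r = subst (_< r) (sym toℕ-twin₁) (<-trans (n<1+n t) (m<m+n s z<s))
    s<r : toℕ twin₂ < r
    s<r = subst (_< r) (sym toℕ-twin₂) (m<m+n s z<s)
    below-universal : ∀ {v} → toℕ v < r → v ≢ u
    below-universal v<r refl = <⇒≱ v<r r≤u
    degree-twin₁ : degree (toℕ twin₁) ≡ suc s
    degree-twin₁ = trans (cong degree toℕ-twin₁) (degree-below-half (n<1+n t))
    degree-twin₂ : degree (toℕ twin₂) ≡ suc s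
    degree-twin₂ = trans (cong degree toℕ-twin₂) (degree-above-half ≤-refl s≤r)

  W₂ : Subset M
  W₂ = ⁅ u₂ ⁆ ∪ ⁅ twin₂ ⁆

  W₂-resolving : Resolving (Kappa threshold) W₂
  W₂-resolving = Kappa-resolving threshold W₂ λ v₁ v₂ v₁∉W₂ v₂∉W₂ agree →
    toℕ-injective (degree-injective (≤r v₁∉W₂) (≤r v₂∉W₂) (≢s v₁∉W₂) (≢s v₂∉W₂)
      (fin-injective (shared-value {R = Kappa threshold} (Kappa-functional threshold)
        (Kappa-to-universal-degree r≤u₂ (≢u₂ v₁∉W₂)) (Kappa-to-universal-degree r≤u₂ (≢u₂ v₂∉W₂))
        (agree u₂ u₂∈W₂))))
    where
    u₂∈W₂ : u₂ ∈ W₂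
    u₂∈W₂ = x∈p∪q⁺ (inj₁ (x∈⁅x⁆ u₂))
    ≢u₂ : ∀ {v} → v ∉ W₂ → v ≢ u₂
    ≢u₂ v∉W₂ refl = v∉W₂ u₂∈W₂
    ≤r : ∀ {v} → v ∉ W₂ → toℕ v ≤ r
    ≤r {v} v∉W₂ = s≤s⁻¹ (≤∧≢⇒< (s≤s⁻¹ (toℕ<n v)) λ v≡1+r →
      ≢u₂ v∉W₂ (toℕ-injective (trans v≡1+r (sym toℕ-u₂))))
    ≢s : ∀ {v} → v ∉ W₂ → toℕ v ≢ s
    ≢s v∉W₂ v≡s = v∉W₂ (x∈p∪q⁺ (inj₂ (subst (_∈ ⁅ twin₂ ⁆) twin₂≡v (x∈⁅x⁆ twin₂))))
      where twin₂≡v = toℕ-injective (trans toℕ-twin₂ (sym v≡s))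

  resolving-has-universal : ∀ {W} → Resolving (Kappa threshold) W → ∃ λ u → u ∈ W × r ≤ toℕ u
  resolving-has-universal {W} resolves with u₁ ∈? W | u₂ ∈? W
  ... | yes u₁∈W | _        = u₁ , u₁∈W , r≤u₁
  ... | no  _    | yes u₂∈W = u₂ , u₂∈W , r≤u₂
  ... | no  u₁∉W | no  u₂∉W = contradiction (resolves u₁ u₂ universals-agree) u₁≢u₂
    where
    universals-agree : ∀ w → w ∈ W → ∃ λ x → Kappa threshold u₁ w x × Kappa threshold u₂ w x
    universals-agree w w∈W = fin (degree (toℕ w)) ,
      Kappa-from-universal-degree r≤u₁ (λ { refl → u₁∉W w∈W }) ,
      Kappa-from-universal-degree r≤u₂ (λ { refl → u₂∉W w∈W })

  cdim-lower : ∀ W → Resolving (Kappa threshold) W → 2 ≤ ∣ W ∣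
  cdim-lower W resolves with resolving-has-universal resolves
  ... | u , u∈W , r≤u with any? (λ w → w ∈? W ×-dec ¬? (w ≟ᶠ u))
  ...   | yes (w , w∈W , w≢u) = two-elements⇒2≤∣W∣ W u∈W w∈W (w≢u ∘ sym)
  ...   | no  only-u          = contradiction (resolves twin₁ twin₂ twins-agree) twin₁≢twin₂
    where
    twins-agree : ∀ w → w ∈ W → ∃ λ x → Kappa threshold twin₁ w x × Kappa threshold twin₂ w x
    twins-agree w w∈W with decidable-stable (w ≟ᶠ u) (λ w≢u → only-u (w , w∈W , w≢u))
    ... | refl = twins-agree-at-universal r≤u

  cdim≡2 : IsCdim threshold 2
  cdim≡2 = (W₂ , W₂-resolving , ≤-antisym ∣W₂∣≤2 (cdim-lower W₂ W₂-resolving)) , cdim-lower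
    where
    ∣W₂∣≤2 : ∣ W₂ ∣ ≤ 2
    ∣W₂∣≤2 = ≤-trans (∣p∪q∣≤∣p∣+∣q∣ ⁅ u₂ ⁆ ⁅ twin₂ ⁆) (≤-reflexive (cong₂ _+_ (∣⁅x⁆∣≡1 u₂) (∣⁅x⁆∣≡1 twin₂)))

  mirror : ℕ → ℕ
  mirror x = r ∸ suc x

  -- Only 2j, 2j+1 and mirror (2j) can separate 2j from 2j+1, and block sends all three to j.
  block : ℕ → ℕ
  block x = ⌊ x ⊓ mirror x /2⌋

  mirror-involutive : ∀ {x} → x < r → mirror (mirror x) ≡ x
  mirror-involutive x<r = trans (cong (r ∸_) (sym (+-∸-assoc 1 x<r))) (m∸[m∸n]≡n (<⇒≤ x<r))

  block-mirror : ∀ {x} → x < r → block (mirror x) ≡ block x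
  block-mirror {x} x<r = cong ⌊_/2⌋ (trans (cong (mirror x ⊓_) (mirror-involutive x<r)) (⊓-comm (mirror x) x))

  block-below-half : ∀ {x} → x < s → block x ≡ ⌊ x /2⌋
  block-below-half {x} x<s = cong ⌊_/2⌋ (m≤n⇒m⊓n≡m (≤-trans (<⇒≤ x<s) s≤mirror-x))
    where
    s≤mirror-x : s ≤ mirror x
    s≤mirror-x = subst (_≤ mirror x) (m+n∸n≡m s s) (∸-monoʳ-≤ r x<s)

  adjacent-step : ∀ {a c} → c ≢ a → c ≢ suc a → suc (a + c) ≢ r → Adjacent a c ⇔ Adjacent (suc a) c
  adjacent-step c≢a c≢1+a 1+a+c≢r = mk⇔
    (λ (_ , r≤a+c)   → c≢1+a ∘ sym , m≤n⇒m≤1+n r≤a+c)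
    (λ (_ , r≤1+a+c) → c≢a ∘ sym , s≤s⁻¹ (≤∧≢⇒< r≤1+a+c (1+a+c≢r ∘ sym)))

  dist-step : ∀ {x y w : Fin M} → toℕ y ≡ suc (toℕ x) → w ≢ x → w ≢ y → suc (toℕ x + toℕ w) ≢ r →
              dist threshold x w ≡ dist threshold y w
  dist-step {x} {y} {w} y≡1+x w≢x w≢y 1+x+w≢r = dist-cong threshold (w≢x ∘ sym) (w≢y ∘ sym) (mk⇔
    (from Adj⇔Adjacent ∘ subst (λ b → Adjacent b (toℕ w)) (sym y≡1+x) ∘ to shift ∘ to Adj⇔Adjacent)
    (from Adj⇔Adjacent ∘ from shift ∘ subst (λ b → Adjacent b (toℕ w)) y≡1+x ∘ to Adj⇔Adjacent))
    where
    shift : Adjacent (toℕ x) (toℕ w) ⇔ Adjacent (suc (toℕ x)) (toℕ w)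
    shift = adjacent-step (w≢x ∘ toℕ-injective) (λ w≡1+x → w≢y (toℕ-injective (trans w≡1+x (sym y≡1+x)))) 1+x+w≢r

  module _ {j : ℕ} (2j+1<s : suc (j + j) < s) where

    private
      a : ℕ
      a = j + j
      a<M : a < M
      a<M = <-trans (n<1+n a) (<-trans 2j+1<s s<M)
      1+a<M : suc a < M
      1+a<M = <-trans 2j+1<s s<M
      x y : Fin M
      x = fromℕ< a<M
      y = fromℕ< 1+a<M
      toℕ-x : toℕ x ≡ a
      toℕ-x = toℕ-fromℕ< a<M
      toℕ-y : toℕ y ≡ suc a
      toℕ-y = toℕ-fromℕ< 1+a<M
      x≢y : x ≢ y
      x≢y x≡y = <⇒≢ (n<1+n a) (trans (sym toℕ-x) (trans (cong toℕ x≡y) toℕ-y))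
      a<r : a < r
      a<r = <-trans (n<1+n a) (<-trans 2j+1<s (m<m+n s z<s))
      block-a : block a ≡ j
      block-a = trans (block-below-half (<-trans (n<1+n a) 2j+1<s)) (sym (n≡⌊n+n/2⌋ j))
      block-1+a : block (suc a) ≡ j
      block-1+a = trans (block-below-half 2j+1<s) (sym (n≡⌈n+n/2⌉ j))

    resolving-meets-block : ∀ {W} → Resolving (Dist threshold) W → ∃ λ w → w ∈ W × block (toℕ w) ≡ j
    resolving-meets-block {W} resolves
      with w , w∈W , dist≢ ← resolving-separates (Dist-functional threshold) (dist threshold)
                                                 (Dist-dist threshold (universal r≤u₁)) resolves x≢y
      with toℕ w ≟ a | toℕ w ≟ suc a | suc (a + toℕ w) ≟ r
    ... | yes w≡a | _         | _           = w , w∈W , trans (cong block w≡a) block-a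
    ... | no _    | yes w≡1+a | _           = w , w∈W , trans (cong block w≡1+a) block-1+a
    ... | no _    | no _      | yes 1+a+w≡r = w , w∈W , trans (cong block w≡mirror-a) (trans (block-mirror a<r) block-a)
      where
      w≡mirror-a : toℕ w ≡ mirror a
      w≡mirror-a = trans (sym (m+n∸m≡n (suc a) (toℕ w))) (cong (_∸ suc a) 1+a+w≡r)
    ... | no w≢a  | no w≢1+a  | no 1+a+w≢r  = contradiction
      (dist-step (trans toℕ-y (cong suc (sym toℕ-x)))
                 (λ w≡x → w≢a (trans (cong toℕ w≡x) toℕ-x))
                 (λ w≡y → w≢1+a (trans (cong toℕ w≡y) toℕ-y))
                 (1+a+w≢r ∘ trans (cong (λ b → suc (b + toℕ w)) (sym toℕ-x))))
      dist≢

  mdim-lower : ∀ {K} → K + K ≤ s → ∀ W → Resolving (Dist threshold) W → K ≤ ∣ W ∣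
  mdim-lower {K} 2K≤s W resolves =
    injection⇒≤∣W∣ W (proj₁ ∘ separator) separator-injective (proj₁ ∘ proj₂ ∘ separator)
    where
    2j+1<s : ∀ (j : Fin K) → suc (toℕ j + toℕ j) < s
    2j+1<s j = subst (_≤ s) (+-suc (suc (toℕ j)) (toℕ j)) (≤-trans (+-mono-≤ (toℕ<n j) (toℕ<n j)) 2K≤s)
    separator : ∀ (j : Fin K) → ∃ λ w → w ∈ W × block (toℕ w) ≡ toℕ j
    separator j = resolving-meets-block (2j+1<s j) resolves
    separator-injective : Injective _≡_ _≡_ (proj₁ ∘ separator)
    separator-injective {i} {j} e = toℕ-injective (begin
      toℕ i                              ≡⟨ proj₂ (proj₂ (separator i)) ⟨
      block (toℕ (proj₁ (separator i))) ≡⟨ cong (block ∘ toℕ) e ⟩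
      block (toℕ (proj₁ (separator j))) ≡⟨ proj₂ (proj₂ (separator j)) ⟩
      toℕ j                              ∎)
      where open ≡-Reasoning

corollary2p10 : (p q : ℕ) → 0 < p → 0 < q →
    Σ ℕ λ n → Σ (Graph (suc n)) λ G → Σ ℕ λ c → Σ ℕ λ m →
      IsCdim G c × IsMdim G m × 0 < m × c * q ≤ p * m
corollary2p10 p q 0<p 0<q =
  suc r , threshold , 2 , m , cdim≡2 , m-is-mdim , 0<m , ≤-trans 2q≤m (m≤n*m m p ⦃ >-nonZero 0<p ⦄)
  where
  open ThresholdGraph (2 * q + 2 * q)
  m-exists = mdim-exists threshold (universal r≤u₁)
  m = proj₁ m-exists
  m-is-mdim = proj₂ m-exists
  2q≤m : 2 * q ≤ m
  2q≤m = IsDim-lower m-is-mdim (mdim-lower (n≤1+n _))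
  0<m : 0 < m
  0<m = ≤-trans 0<q (≤-trans (m≤n*m q 2) 2q≤m)
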